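{- Let $j,r,k$ be non-negative integers with $j+r\le k$. Let $\mathcal{Y}_{j,r,k}$ be the set of frequency sequences $(f_i)_{i\ge0}$ with $f_i+f_{i+1}\le k$ for all $i\ge0$ and $f_0\in\{\ell+\max\{\ell-(j-r),0\} : 0\le\ell\le j\}$, and let $\mathcal{Z}_{j,r,k}$ be the set of frequency sequences $(f_i)_{i\ge0}$ with $f_i+f_{i+1}\le k$ for all $i\ge0$ and $f_0\le j-\max\{f_0+f_1-(k-r),0\}$. Then there exists a size-preserving bijection from $\mathcal{Y}_{j,r,k}$ to $\mathcal{Z}_{j,r,k}$.
   Context: A frequency sequence is a sequence $(f_i)_{i\ge0}$ of non-negative integers with finitely many nonzero entries; its size is $|f|=\sum_{i\ge0}if_i$. -}

module Defs where

open import Data.Nat using (ℕ; zero; suc; _+_; _*_; _∸_; _≤_)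
open import Data.Product using (Σ; ∃; ∃-syntax; _×_; _,_; proj₁; proj₂)
open import Relation.Binary.PropositionalEquality using (_≡_)

FreqSeq : Set
FreqSeq = Σ (ℕ → ℕ) λ f → ∃[ N ] (∀ i → N ≤ i → f i ≡ 0)

seq : FreqSeq → (ℕ → ℕ)
seq = proj₁

partialSize : (ℕ → ℕ) → ℕ → ℕ
partialSize f zero = 0
partialSize f (suc n) = partialSize f n + n * f n

-- size |f| = Σ_{i ≥ 0} i f_i, computed up to the support bound
-- (independent of which bound is chosen).
size : FreqSeq → ℕ
size (f , N , _) = partialSize f N

Gordon : ℕ → FreqSeq → Set
Gordon k F = ∀ i → seq F i + seq F (suc i) ≤ k

-- Y_{j,r,k}: f_0 = ℓ + max{ℓ - (j - r), 0} for some 0 ≤ ℓ ≤ j.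
-- Over ℤ, max{ℓ - (j - r), 0} = (ℓ + r) ∸ j.
InY : ℕ → ℕ → ℕ → FreqSeq → Set
InY j r k F = Gordon k F × (∃[ ℓ ] (ℓ ≤ j × seq F 0 ≡ ℓ + ((ℓ + r) ∸ j)))

-- Z_{j,r,k}: f_0 ≤ j - max{f_0 + f_1 - (k - r), 0}  (integer subtraction),
-- i.e. f_0 + ((f_0 + f_1 + r) ∸ k) ≤ j.
InZ : ℕ → ℕ → ℕ → FreqSeq → Set
InZ j r k F = Gordon k F × (seq F 0 + ((seq F 0 + seq F 1 + r) ∸ k) ≤ j)

Y : ℕ → ℕ → ℕ → Set
Y j r k = Σ FreqSeq (InY j r k)

Z : ℕ → ℕ → ℕ → Set
Z j r k = Σ FreqSeq (InZ j r k)

_≋_ : FreqSeq → FreqSeq → Set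
F ≋ G = ∀ i → seq F i ≡ seq G i

record SizePreservingBijection (P Q : FreqSeq → Set) : Set where
  field
    to      : Σ FreqSeq P → Σ FreqSeq Q
    from    : Σ FreqSeq Q → Σ FreqSeq P
    to-cong   : ∀ x y → proj₁ x ≋ proj₁ y → proj₁ (to x) ≋ proj₁ (to y)
    from-cong : ∀ x y → proj₁ x ≋ proj₁ y → proj₁ (from x) ≋ proj₁ (from y)
    from-to : ∀ x → proj₁ (from (to x)) ≋ proj₁ x
    to-from : ∀ y → proj₁ (to (from y)) ≋ proj₁ y
    to-size : ∀ x → size (proj₁ (to x)) ≡ size (proj₁ x)

-- The conditions defining Y and Z involve only f₀ and f₁, and f₀ has weight 0 in the size.
-- The map ℓ ↦ φ ℓ = ℓ + max{ℓ - (j - r), 0} is strictly increasing, and with b = f₁ both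
-- "ℓ ≤ j, φ ℓ + b ≤ k" and "ℓ + b ≤ k, ℓ + max{ℓ + b - (k - r), 0} ≤ j" amount to
-- ℓ ≤ j, ℓ + b ≤ k and 2ℓ + b + r ≤ j + k. So replacing f₀ = φ ℓ by ℓ maps Y onto Z.
module Submission where

open import Defs
open import Data.Nat using (ℕ; zero; suc; _+_; _*_; _∸_; _≤_; _<_; _≤?_; s≤s)
open import Data.Nat.Properties
open import Data.Nat.Tactic.RingSolver using (solve-∀)
open import Data.Product using (Σ; _×_; _,_; proj₁; proj₂)
open import Data.Empty using (⊥-elim)
open import Function.Base using (_∘_)
open import Function.Bundles using (_⇔_; mk⇔; module Equivalence)
open import Relation.Binary.Definitions using (tri<; tri≈; tri>)
open import Relation.Binary.PropositionalEquality
open import Relation.Nullary using (yes; no)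

open import Algebra.Properties.CommutativeSemigroup +-commutativeSemigroup
  using (x∙yz≈xz∙y; xy∙z≈xz∙y)

open Equivalence using (to; from)

m+n+[m+o]≡m+[m+n+o] : ∀ m n o → m + n + (m + o) ≡ m + (m + n + o)
m+n+[m+o]≡m+[m+n+o] = solve-∀

m+[n∸o]≤p⇔ : ∀ m n o p → m + (n ∸ o) ≤ p ⇔ (m ≤ p × m + n ≤ p + o)
m+[n∸o]≤p⇔ m n o p = mk⇔ forward backward
  where
  forward : m + (n ∸ o) ≤ p → m ≤ p × m + n ≤ p + o
  forward h = ≤-trans (m≤m+n m _) h
            , (begin
                m + n             ≤⟨ +-monoʳ-≤ m (m≤n+m∸n n o) ⟩
                m + (o + (n ∸ o)) ≡⟨ x∙yz≈xz∙y m o (n ∸ o) ⟩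
                m + (n ∸ o) + o   ≤⟨ +-monoˡ-≤ o h ⟩
                p + o             ∎)
    where open ≤-Reasoning
  backward : m ≤ p × m + n ≤ p + o → m + (n ∸ o) ≤ p
  backward (m≤p , m+n≤p+o) with n ≤? o
  ... | yes n≤o rewrite m≤n⇒m∸n≡0 n≤o | +-identityʳ m = m≤p
  ... | no n≰o = +-cancelʳ-≤ o (m + (n ∸ o)) p
    (begin
      m + (n ∸ o) + o ≡⟨ +-assoc m _ o ⟩
      m + (n ∸ o + o) ≡⟨ cong (m +_) (m∸n+n≡m (<⇒≤ (≰⇒> n≰o))) ⟩
      m + n           ≤⟨ m+n≤p+o ⟩
      p + o           ∎)
    where open ≤-Reasoning

φ : ℕ → ℕ → ℕ → ℕ
φ j r ℓ = ℓ + ((ℓ + r) ∸ j)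

φ-strictMono : ∀ j r {a b} → a < b → φ j r a < φ j r b
φ-strictMono j r a<b = +-mono-<-≤ a<b (∸-monoˡ-≤ j (+-monoˡ-≤ r (<⇒≤ a<b)))

φ-injective : ∀ j r {a b} → φ j r a ≡ φ j r b → a ≡ b
φ-injective j r {a} {b} φa≡φb with <-cmp a b
... | tri< a<b _ _ = ⊥-elim (<-irrefl φa≡φb (φ-strictMono j r a<b))
... | tri≈ _ a≡b _ = a≡b
... | tri> _ _ b<a = ⊥-elim (<-irrefl (sym φa≡φb) (φ-strictMono j r b<a))

φ+b≤k⇔ : ∀ j r k ℓ b → φ j r ℓ + b ≤ k ⇔ (ℓ + b ≤ k × ℓ + b + (ℓ + r) ≤ k + j)
φ+b≤k⇔ j r k ℓ b =
  subst (λ x → x ≤ k ⇔ (ℓ + b ≤ k × ℓ + b + (ℓ + r) ≤ k + j))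
        (sym (xy∙z≈xz∙y ℓ ((ℓ + r) ∸ j) b))
        (m+[n∸o]≤p⇔ (ℓ + b) (ℓ + r) j k)

-- Both bounds are 2ℓ + b + r ≤ j + k, written in the two shapes the cases produce.
Y-head⇒Z-head : ∀ j r k ℓ b → ℓ ≤ j → φ j r ℓ + b ≤ k →
  ℓ + b ≤ k × ℓ + ((ℓ + b + r) ∸ k) ≤ j
Y-head⇒Z-head j r k ℓ b ℓ≤j h with to (φ+b≤k⇔ j r k ℓ b) h
... | ℓ+b≤k , bound = ℓ+b≤k , from (m+[n∸o]≤p⇔ ℓ (ℓ + b + r) k j)
  (ℓ≤j , subst₂ _≤_ (m+n+[m+o]≡m+[m+n+o] ℓ b r) (+-comm k j) bound)

Z-head⇒Y-head : ∀ j r k ℓ b → ℓ + b ≤ k → ℓ + ((ℓ + b + r) ∸ k) ≤ j →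
  ℓ ≤ j × φ j r ℓ + b ≤ k
Z-head⇒Y-head j r k ℓ b ℓ+b≤k h with to (m+[n∸o]≤p⇔ ℓ (ℓ + b + r) k j) h
... | ℓ≤j , bound = ℓ≤j , from (φ+b≤k⇔ j r k ℓ b)
  (ℓ+b≤k , subst₂ _≤_ (sym (m+n+[m+o]≡m+[m+n+o] ℓ b r)) (+-comm j k) bound)

setHead : ℕ → (ℕ → ℕ) → ℕ → ℕ
setHead v f zero    = v
setHead v f (suc i) = f (suc i)

-- The support bound grows by one, since the new head may be nonzero even if f vanishes.
setHeadFreq : ℕ → FreqSeq → FreqSeq
setHeadFreq v (f , N , f≡0) = setHead v f , suc N , vanish
  where
  vanish : ∀ i → suc N ≤ i → setHead v f i ≡ 0
  vanish (suc i) (s≤s N≤i) = f≡0 (suc i) (m≤n⇒m≤1+n N≤i)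

partialSize-setHead : ∀ v f n → partialSize (setHead v f) n ≡ partialSize f n
partialSize-setHead v f zero          = refl
partialSize-setHead v f (suc zero)    = refl
partialSize-setHead v f (suc (suc n)) =
  cong (_+ suc n * f (suc n)) (partialSize-setHead v f (suc n))

partialSize-suc : ∀ f n → f n ≡ 0 → partialSize f (suc n) ≡ partialSize f n
partialSize-suc f n fn≡0 rewrite fn≡0 | *-zeroʳ n = +-identityʳ (partialSize f n)

size-setHeadFreq : ∀ v F → size (setHeadFreq v F) ≡ size F
size-setHeadFreq v (f , N , f≡0) = begin
  partialSize (setHead v f) (suc N) ≡⟨ partialSize-setHead v f (suc N) ⟩
  partialSize f (suc N)             ≡⟨ partialSize-suc f N (f≡0 N ≤-refl) ⟩
  partialSize f N                   ∎
  where open ≡-Reasoning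

setHeadFreq-Gordon : ∀ {k} v F → v + seq F 1 ≤ k → Gordon k F → Gordon k (setHeadFreq v F)
setHeadFreq-Gordon v F v+f₁≤k gordon zero    = v+f₁≤k
setHeadFreq-Gordon v F v+f₁≤k gordon (suc i) = gordon (suc i)

setHead≗ : ∀ {v} {f g : ℕ → ℕ} → v ≡ g 0 → (∀ i → f (suc i) ≡ g (suc i)) →
  ∀ i → setHead v f i ≡ g i
setHead≗ v≡g₀ tail≡ zero    = v≡g₀
setHead≗ v≡g₀ tail≡ (suc i) = tail≡ i

Y→Z : ∀ j r k → Σ FreqSeq (InY j r k) → Σ FreqSeq (InZ j r k)
Y→Z j r k (F , gordon , ℓ , ℓ≤j , f₀≡φℓ) =
  setHeadFreq ℓ F , setHeadFreq-Gordon ℓ F (proj₁ zHead) gordon , proj₂ zHead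
  where
  zHead : ℓ + seq F 1 ≤ k × ℓ + ((ℓ + seq F 1 + r) ∸ k) ≤ j
  zHead = Y-head⇒Z-head j r k ℓ (seq F 1) ℓ≤j
    (subst (λ f₀ → f₀ + seq F 1 ≤ k) f₀≡φℓ (gordon 0))

Z→Y : ∀ j r k → Σ FreqSeq (InZ j r k) → Σ FreqSeq (InY j r k)
Z→Y j r k (F , gordon , zHead) =
  setHeadFreq (φ j r (seq F 0)) F , setHeadFreq-Gordon _ F (proj₂ yHead) gordon
  , seq F 0 , proj₁ yHead , refl
  where
  yHead : seq F 0 ≤ j × φ j r (seq F 0) + seq F 1 ≤ k
  yHead = Z-head⇒Y-head j r k (seq F 0) (seq F 1) (gordon 0) zHead

proposition6p7 : (j r k : ℕ) → j + r ≤ k →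
    SizePreservingBijection (InY j r k) (InZ j r k)
proposition6p7 j r k _ = record
  { to        = Y→Z j r k
  ; from      = Z→Y j r k
  ; to-cong   = λ { (_ , _ , _ , _ , f₀≡φℓ) (_ , _ , _ , _ , g₀≡φℓ') F≋G →
                  setHead≗ (φ-injective j r (trans (sym f₀≡φℓ) (trans (F≋G 0) g₀≡φℓ')))
                           (F≋G ∘ suc) }
  ; from-cong = λ _ _ F≋G → setHead≗ (cong (φ j r) (F≋G 0)) (F≋G ∘ suc)
  ; from-to   = λ { (_ , _ , _ , _ , f₀≡φℓ) → setHead≗ (sym f₀≡φℓ) (λ _ → refl) }
  ; to-from   = λ _ → setHead≗ refl (λ _ → refl)
  ; to-size   = λ { (F , _ , ℓ , _) → size-setHeadFreq ℓ F }
  }
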